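{- Let $n\ge3$ and let $\vec p$ be a regular parameter vector with at least one neutral label. Let $A$ and $B$ be the smallest and largest neutral labels. Then: (i) every label in $[A,B]$ is neutral; (ii) if $A=1$ or $B=n$, then $p_{i,j}=1/2$ for all $i\ne j$; (iii) if not all $p_{i,j}$ equal $1/2$ (so that $2\le A\le B\le n-1$), then $p_{i,j}=1/2$ for every non-crossing pair $1\le i<j\le n$. In particular, for $i<A$, the label $i$ is non-neutral if and only if there exists $k>B$ with $p_{i,k}>1/2$; and for $j>B$, the label $j$ is non-neutral if and only if there exists $k<A$ with $p_{k,j}>1/2$.
   Context: A parameter vector is $\vec p=(p_{i,j})_{i\ne j,\ i,j\in[n]}$ with $p_{i,j}\in(0,1)$, $p_{i,j}+p_{j,i}=1$; it is regular if $p_{i-1,i}\ge1/2$ ($2\le i\le n$), $p_{i-1,j}\ge p_{i,j}$ ($2\le i<j\le n$), $p_{i,j+1}\ge p_{i,j}$ ($1\le i<j\le n-1$). A label $c$ is neutral if $p_{c,i}=p_{i,c}=1/2$ for all $i\ne c$. A pair $1\le i<j\le n$ is crossing if $i<A$ and $j>B$, and non-crossing otherwise.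
   Formalization: The parameters $p_{i,j}$ take rational values in $(0,1)$. -}

module Defs where

open import Data.Nat using (ℕ; _≤_; _<_; _∸_; suc)
open import Data.Rational using (ℚ; 0ℚ; 1ℚ; ½) renaming (_+_ to _+ℚ_; _<_ to _<ℚ_; _≤_ to _≤ℚ_)
open import Data.Product using (_×_; ∃)
open import Relation.Binary.PropositionalEquality using (_≡_; _≢_)

-- Labels are the natural numbers 1..n; a parameter vector is a function
-- p : ℕ → ℕ → ℚ, of which only the entries p i j with i ≠ j in [n] matter.
Param : Set
Param = ℕ → ℕ → ℚ

InRange : ℕ → ℕ → Set
InRange n i = 1 ≤ i × i ≤ n

IsParamVector : ℕ → Param → Set
IsParamVector n p = ∀ i j → InRange n i → InRange n j → i ≢ j →
  (0ℚ <ℚ p i j) × (p i j <ℚ 1ℚ) × (p i j +ℚ p j i ≡ 1ℚ)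

IsRegular : ℕ → Param → Set
IsRegular n p = IsParamVector n p ×
  ((∀ i → 2 ≤ i → i ≤ n → ½ ≤ℚ p (i ∸ 1) i) ×
   (∀ i j → 2 ≤ i → i < j → j ≤ n → p i j ≤ℚ p (i ∸ 1) j) ×
   (∀ i j → 1 ≤ i → i < j → j ≤ n ∸ 1 → p i j ≤ℚ p i (suc j)))

Neutral : ℕ → Param → ℕ → Set
Neutral n p c = InRange n c ×
  (∀ i → InRange n i → i ≢ c → (p c i ≡ ½) × (p i c ≡ ½))

IsSmallestNeutral : ℕ → Param → ℕ → Set
IsSmallestNeutral n p A = Neutral n p A × (∀ c → Neutral n p c → A ≤ c)

IsLargestNeutral : ℕ → Param → ℕ → Set
IsLargestNeutral n p B = Neutral n p B × (∀ c → Neutral n p c → c ≤ B)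

AllHalf : ℕ → Param → Set
AllHalf n p = ∀ i j → InRange n i → InRange n j → i ≢ j → p i j ≡ ½

Crossing : ℕ → ℕ → ℕ → ℕ → Set
Crossing A B i j = (i < A) × (B < j)

-- Regularity makes p ≥ ½ above the diagonal, non-increasing down each column
-- and non-decreasing along each row.  Hence a neutral label c squeezes
-- p i j = ½ for every pair i < j with c ≤ i (between ½ and p c j = ½) or with
-- j ≤ c (between ½ and p i c = ½); with c = A and c = B this covers every
-- non-crossing pair, and p i j + p j i = 1 transfers it to the reversed pairs.
-- A label outside [A, B] is then neutral exactly when all its crossing entries,
-- which are ≥ ½, equal ½; constructively the witness k is found by bounded search.
module Submission where

open import Defs
open import Data.Nat using (ℕ; zero; suc; s≤s; _≤_; _<_; _∸_; _<?_; _≤?_)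
open import Data.Nat.Properties
  using (≤-refl; ≤-trans; <-trans; <-≤-trans; ≤-<-trans; <⇒≤; <⇒≤pred; <⇒≢; >⇒≢;
         ≤∧≢⇒<; ≮⇒≥; m≤n⇒m<n∨m≡n; n<1+n; n≤1+n; <-cmp; anyUpTo?)
open import Data.Rational using (½; 1ℚ) renaming (_+_ to _+ℚ_; _<_ to _<ℚ_; _≤_ to _≤ℚ_)
import Data.Rational.Properties as ℚ
open import Algebra.Properties.Group ℚ.+-0-group using (∙-cancelˡ)
open import Data.Product using (_×_; ∃; _,_; proj₁; proj₂)
open import Data.Sum using (_⊎_; inj₁; inj₂)
open import Data.Empty using (⊥-elim)
open import Function.Bundles using (_⇔_; mk⇔)
open import Relation.Binary using (tri<; tri≈; tri>)
open import Relation.Binary.PropositionalEquality using (_≡_; _≢_; refl; sym; subst)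
open import Relation.Nullary using (¬_; Dec; yes; no)
open import Relation.Nullary.Decidable using (_×-dec_; map′; decidable-stable)
open import Relation.Unary using (Decidable)

∃-above? : {P : ℕ → Set} → Decidable P → ∀ b n → Dec (∃ λ k → b < k × k ≤ n × P k)
∃-above? P? b n = map′
  (λ { (k , s≤s k≤n , b<k , Pk) → k , b<k , k≤n , Pk })
  (λ { (k , b<k , k≤n , Pk) → k , s≤s k≤n , b<k , Pk })
  (anyUpTo? (λ k → (b <? k) ×-dec P? k) (suc n))

∃-below? : {P : ℕ → Set} → Decidable P → ∀ a → Dec (∃ λ k → 1 ≤ k × k < a × P k)
∃-below? P? a = map′
  (λ { (k , k<a , 1≤k , Pk) → k , 1≤k , k<a , Pk })
  (λ { (k , 1≤k , k<a , Pk) → k , k<a , 1≤k , Pk })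
  (anyUpTo? (λ k → (1 ≤? k) ×-dec P? k) a)

¬Crossing⇒≤ : ∀ {A B i j} → ¬ Crossing A B i j → A ≤ i ⊎ j ≤ B
¬Crossing⇒≤ {A} {B} {i} {j} ¬crossing with i <? A | B <? j
... | no i≮A  | _       = inj₁ (≮⇒≥ i≮A)
... | yes _   | no B≮j  = inj₂ (≮⇒≥ B≮j)
... | yes i<A | yes B<j = ⊥-elim (¬crossing (i<A , B<j))

module ParamVector {n : ℕ} {p : Param} (pv : IsParamVector n p) where

  ½-sym : ∀ {i j} → InRange n i → InRange n j → i ≢ j → p i j ≡ ½ → p j i ≡ ½
  ½-sym {i} {j} ri rj i≢j pij≡½ = ∙-cancelˡ ½ (p j i) ½ ½+pji≡½+½
    where
    -- ½ +ℚ ½ computes to 1ℚ.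
    ½+pji≡½+½ : ½ +ℚ p j i ≡ ½ +ℚ ½
    ½+pji≡½+½ = subst (λ x → x +ℚ p j i ≡ 1ℚ) pij≡½ (proj₂ (proj₂ (pv i j ri rj i≢j)))

  neutral-from-upper : ∀ {c} → InRange n c →
    (∀ i → 1 ≤ i → i < c → p i c ≡ ½) → (∀ j → c < j → j ≤ n → p c j ≡ ½) →
    Neutral n p c
  neutral-from-upper {c} rc below above = rc , entries
    where
    entries : ∀ i → InRange n i → i ≢ c → (p c i ≡ ½) × (p i c ≡ ½)
    entries i ri i≢c with <-cmp i c
    ... | tri< i<c _ _ = let e = below i (proj₁ ri) i<c in ½-sym ri rc i≢c e , e
    ... | tri≈ _ i≡c _ = ⊥-elim (i≢c i≡c)
    ... | tri> _ _ c<i = let e = above i c<i (proj₂ ri) in e , ½-sym rc ri (λ c≡i → i≢c (sym c≡i)) e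

  allHalf-from-upper : (∀ i j → 1 ≤ i → i < j → j ≤ n → p i j ≡ ½) → AllHalf n p
  allHalf-from-upper upper i j ri rj i≢j with <-cmp i j
  ... | tri< i<j _ _ = upper i j (proj₁ ri) i<j (proj₂ rj)
  ... | tri≈ _ i≡j _ = ⊥-elim (i≢j i≡j)
  ... | tri> _ _ j<i = ½-sym rj ri (λ j≡i → i≢j (sym j≡i)) (upper j i (proj₁ rj) j<i (proj₂ ri))

module Regular {n : ℕ} {p : Param} (reg : IsRegular n p) where

  open ParamVector (proj₁ reg) public

  private
    ½≤superdiagonal = proj₁ (proj₂ reg)
    column-step     = proj₁ (proj₂ (proj₂ reg))
    row-step        = proj₂ (proj₂ (proj₂ reg))

  p-antitoneˡ : ∀ {i i′ j} → 1 ≤ i → i ≤ i′ → i′ < j → j ≤ n → p i′ j ≤ℚ p i j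
  p-antitoneˡ {i′ = zero} (s≤s _) () _ _
  p-antitoneˡ {i′ = suc i′} 1≤i i≤i′ i′<j j≤n with m≤n⇒m<n∨m≡n i≤i′
  ... | inj₂ refl = ℚ.≤-refl
  ... | inj₁ (s≤s i≤i′-1) = ℚ.≤-trans
    (column-step (suc i′) _ (s≤s (≤-trans 1≤i i≤i′-1)) i′<j j≤n)
    (p-antitoneˡ {i′ = i′} 1≤i i≤i′-1 (<-trans (n<1+n i′) i′<j) j≤n)

  p-monotoneʳ : ∀ {i j k} → 1 ≤ i → i < j → j ≤ k → k ≤ n → p i j ≤ℚ p i k
  p-monotoneʳ {k = zero} _ (s≤s _) () _
  p-monotoneʳ {k = suc k} 1≤i i<j j≤k k≤n with m≤n⇒m<n∨m≡n j≤k
  ... | inj₂ refl = ℚ.≤-refl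
  ... | inj₁ (s≤s j≤k-1) = ℚ.≤-trans
    (p-monotoneʳ {k = k} 1≤i i<j j≤k-1 (≤-trans (n≤1+n k) k≤n))
    (row-step _ k 1≤i (<-≤-trans i<j j≤k-1) (<⇒≤pred k≤n))

  ½≤p : ∀ {i j} → 1 ≤ i → i < j → j ≤ n → ½ ≤ℚ p i j
  ½≤p {i} 1≤i i<j j≤n =
    ℚ.≤-trans (½≤superdiagonal (suc i) (s≤s 1≤i) (≤-trans i<j j≤n)) (p-monotoneʳ 1≤i ≤-refl i<j j≤n)

  ¬½<p⇒p≡½ : ∀ {i j} → 1 ≤ i → i < j → j ≤ n → ¬ (½ <ℚ p i j) → p i j ≡ ½
  ¬½<p⇒p≡½ 1≤i i<j j≤n ¬½<p = ℚ.≤-antisym (ℚ.≮⇒≥ ¬½<p) (½≤p 1≤i i<j j≤n)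

  ½-right-of-neutral : ∀ {c i j} → Neutral n p c → c ≤ i → i < j → j ≤ n → p i j ≡ ½
  ½-right-of-neutral {c} {i} {j} (rc , entries) c≤i i<j j≤n = ℚ.≤-antisym
    (subst (p i j ≤ℚ_) (proj₁ (entries j (≤-trans (proj₁ rc) (<⇒≤ c<j) , j≤n) (>⇒≢ c<j)))
      (p-antitoneˡ (proj₁ rc) c≤i i<j j≤n))
    (½≤p (≤-trans (proj₁ rc) c≤i) i<j j≤n)
    where c<j = ≤-<-trans c≤i i<j

  ½-left-of-neutral : ∀ {c i j} → Neutral n p c → 1 ≤ i → i < j → j ≤ c → p i j ≡ ½
  ½-left-of-neutral {c} {i} {j} (rc , entries) 1≤i i<j j≤c = ℚ.≤-antisym
    (subst (p i j ≤ℚ_) (proj₂ (entries i (1≤i , ≤-trans (<⇒≤ i<c) (proj₂ rc)) (<⇒≢ i<c)))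
      (p-monotoneʳ 1≤i i<j j≤c (proj₂ rc)))
    (½≤p 1≤i i<j (≤-trans j≤c (proj₂ rc)))
    where i<c = <-≤-trans i<j j≤c

module ExtremeNeutrals {n : ℕ} {p : Param} (reg : IsRegular n p) {A B : ℕ}
  (smallest : IsSmallestNeutral n p A) (largest : IsLargestNeutral n p B) where

  open Regular reg

  private
    neutral-A = proj₁ smallest
    neutral-B = proj₁ largest
    1≤A = proj₁ (proj₁ neutral-A)
    A≤n = proj₂ (proj₁ neutral-A)
    1≤B = proj₁ (proj₁ neutral-B)
    B≤n = proj₂ (proj₁ neutral-B)
    A≤B = proj₂ smallest B neutral-B

  ½-off-crossing : ∀ {i j} → 1 ≤ i → i < j → j ≤ n → A ≤ i ⊎ j ≤ B → p i j ≡ ½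
  ½-off-crossing 1≤i i<j j≤n (inj₁ A≤i) = ½-right-of-neutral neutral-A A≤i i<j j≤n
  ½-off-crossing 1≤i i<j j≤n (inj₂ j≤B) = ½-left-of-neutral neutral-B 1≤i i<j j≤B

  neutral-between : ∀ c → A ≤ c → c ≤ B → Neutral n p c
  neutral-between c A≤c c≤B = neutral-from-upper (≤-trans 1≤A A≤c , ≤-trans c≤B B≤n)
    (λ i 1≤i i<c → ½-off-crossing 1≤i i<c (≤-trans c≤B B≤n) (inj₂ c≤B))
    (λ j c<j j≤n → ½-off-crossing (≤-trans 1≤A A≤c) c<j j≤n (inj₁ A≤c))

  allHalf-if-extreme : A ≡ 1 ⊎ B ≡ n → AllHalf n p
  allHalf-if-extreme (inj₁ refl) =
    allHalf-from-upper λ i j 1≤i i<j j≤n → ½-off-crossing 1≤i i<j j≤n (inj₁ 1≤i)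
  allHalf-if-extreme (inj₂ refl) =
    allHalf-from-upper λ i j 1≤i i<j j≤n → ½-off-crossing 1≤i i<j j≤n (inj₂ j≤n)

  non-neutral-left⇔ : ∀ i → 1 ≤ i → i < A →
    (¬ Neutral n p i) ⇔ (∃ λ k → B < k × k ≤ n × ½ <ℚ p i k)
  non-neutral-left⇔ i 1≤i i<A = mk⇔
    (λ ¬neutral → decidable-stable (∃-above? (λ k → ½ ℚ.<? p i k) B n) (λ ∄ → ¬neutral (neutral-if-∄ ∄)))
    (λ { (k , B<k , k≤n , ½<pik) (_ , entries) → ℚ.<-irrefl
           (sym (proj₁ (entries k (≤-trans 1≤B (<⇒≤ B<k) , k≤n) (>⇒≢ (<-trans i<B B<k))))) ½<pik })
    where
    i<B = <-≤-trans i<A A≤B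
    neutral-if-∄ : ¬ (∃ λ k → B < k × k ≤ n × ½ <ℚ p i k) → Neutral n p i
    neutral-if-∄ ∄ = neutral-from-upper (1≤i , ≤-trans (<⇒≤ i<B) B≤n)
      (λ m 1≤m m<i → ½-off-crossing 1≤m m<i (≤-trans (<⇒≤ i<B) B≤n) (inj₂ (<⇒≤ i<B)))
      above
      where
      above : ∀ k → i < k → k ≤ n → p i k ≡ ½
      above k i<k k≤n with B <? k
      ... | yes B<k = ¬½<p⇒p≡½ 1≤i i<k k≤n (λ ½<pik → ∄ (k , B<k , k≤n , ½<pik))
      ... | no B≮k  = ½-off-crossing 1≤i i<k k≤n (inj₂ (≮⇒≥ B≮k))

  non-neutral-right⇔ : ∀ j → B < j → j ≤ n →
    (¬ Neutral n p j) ⇔ (∃ λ k → 1 ≤ k × k < A × ½ <ℚ p k j)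
  non-neutral-right⇔ j B<j j≤n = mk⇔
    (λ ¬neutral → decidable-stable (∃-below? (λ k → ½ ℚ.<? p k j) A) (λ ∄ → ¬neutral (neutral-if-∄ ∄)))
    (λ { (k , 1≤k , k<A , ½<pkj) (_ , entries) → ℚ.<-irrefl
           (sym (proj₂ (entries k (1≤k , ≤-trans (<⇒≤ k<A) A≤n) (<⇒≢ (<-trans k<A A<j))))) ½<pkj })
    where
    A<j = ≤-<-trans A≤B B<j
    neutral-if-∄ : ¬ (∃ λ k → 1 ≤ k × k < A × ½ <ℚ p k j) → Neutral n p j
    neutral-if-∄ ∄ = neutral-from-upper (≤-trans 1≤A (<⇒≤ A<j) , j≤n)
      below
      (λ m j<m m≤n → ½-off-crossing (≤-trans 1≤A (<⇒≤ A<j)) j<m m≤n (inj₁ (<⇒≤ A<j)))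
      where
      below : ∀ k → 1 ≤ k → k < j → p k j ≡ ½
      below k 1≤k k<j with k <? A
      ... | yes k<A = ¬½<p⇒p≡½ 1≤k k<j j≤n (λ ½<pkj → ∄ (k , 1≤k , k<A , ½<pkj))
      ... | no k≮A  = ½-off-crossing 1≤k k<j j≤n (inj₁ (≮⇒≥ k≮A))

  interior-if-¬allHalf : ¬ AllHalf n p → 2 ≤ A × B ≤ n ∸ 1
  interior-if-¬allHalf ¬allHalf =
    ≤∧≢⇒< 1≤A (λ 1≡A → ¬allHalf (allHalf-if-extreme (inj₁ (sym 1≡A)))) ,
    <⇒≤pred (≤∧≢⇒< B≤n (λ B≡n → ¬allHalf (allHalf-if-extreme (inj₂ B≡n))))

lemma6p2 : (n : ℕ) → 3 ≤ n → (p : Param) → IsRegular n p →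
    (∃ λ c → Neutral n p c) →
    (A B : ℕ) → IsSmallestNeutral n p A → IsLargestNeutral n p B →
    ((∀ c → A ≤ c → c ≤ B → Neutral n p c) ×
     ((A ≡ 1 ⊎ B ≡ n) → AllHalf n p) ×
     (¬ AllHalf n p →
       (2 ≤ A × B ≤ n ∸ 1) ×
       (∀ i j → 1 ≤ i → i < j → j ≤ n → ¬ Crossing A B i j → p i j ≡ ½) ×
       (∀ i → 1 ≤ i → i < A →
         ((¬ Neutral n p i) ⇔ (∃ λ k → B < k × k ≤ n × ½ <ℚ p i k))) ×
       (∀ j → B < j → j ≤ n →
         ((¬ Neutral n p j) ⇔ (∃ λ k → 1 ≤ k × k < A × ½ <ℚ p k j)))))
lemma6p2 n _ p reg _ A B smallest largest =
  neutral-between ,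
  allHalf-if-extreme ,
  λ ¬allHalf →
    interior-if-¬allHalf ¬allHalf ,
    (λ i j 1≤i i<j j≤n ¬crossing → ½-off-crossing 1≤i i<j j≤n (¬Crossing⇒≤ ¬crossing)) ,
    non-neutral-left⇔ ,
    non-neutral-right⇔
  where open ExtremeNeutrals reg smallest largest
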